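{- Let $\mathbb{K}$ be an infinite field, let $\ell\geq 3$, let $\mathcal{H}=(V,E)$ be an $\ell$-uniform hypergraph, and let $\delta=(\delta_a\mid a\in[\ell])$ be a $C$-signal of $\mathcal{H}$. If $x,y\in V$ lie in the same connected component of $\mathcal{H}$, then $\delta_a(x)=\delta_b(y)$ for all $a,b\in[\ell]$.
   Context: Notation: $[\ell]=\{1,\dots,\ell\}$, $\mathrm{Sym}(\ell)$ is the symmetric group on $[\ell]$; for $f\in Y^{[\ell]}$ and $\sigma\in\mathrm{Sym}(\ell)$, $f^{\sigma}(a)=f(a^{\sigma})$. An $\ell$-uniform hypergraph is a pair $\mathcal{H}=(V,E)$ of finite sets where $E$ is a set of orbits of $V^{\ell}$ (functions $[\ell]\to V$) under this action of $\mathrm{Sym}(\ell)$; an edge $e\in E$ is regarded via a representative as an element of $V^{\ell}$, with $e^{\sigma}$ the other elements of its orbit. A walk is a sequence $x_1,e_1,x_2,\dots,e_{m-1},x_m$ of vertices and edges such that for each $i$ there are $a_i,b_i\in[\ell]$ with $e_i(a_i)=x_i$ and $e_i(b_i)=x_{i+1}$; connected components are the classes of the relation "there is a walk from $x$ to $y$". The linear map $C:\mathbb{K}^{\ell}\to\mathbb{K}^{\ell-1}$ is $C(\lambda)(i)=\lambda(i)-\lambda(i+1)$ for $i\in[\ell-1]$. For a linear map $T:\mathbb{K}^{\ell}\to\mathbb{K}^r$, a $T$-signal of $\mathcal{H}$ is a function $\delta:[\ell]\to\mathbb{K}^V$, $a\mapsto\delta_a$, such that for all $e\in E$ and $\sigma\in\mathrm{Sym}(\ell)$,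 $T(\delta*e^{\sigma})=0$, where $(\delta*e^{\sigma})(a)=\delta_a(e^{\sigma}(a))$. -}

module Defs where

open import Level using (Level; _⊔_; suc)
open import Data.Nat using (ℕ; zero; pred) renaming (suc to sucℕ)
open import Data.Fin using (Fin; inject₁) renaming (suc to fsuc)
open import Data.Product using (Σ; ∃; _×_; _,_)
open import Relation.Nullary using (¬_)
open import Algebra.Bundles using (CommutativeRing)
open import Data.Fin.Permutation using (Permutation′; _⟨$⟩ʳ_)

record Field (c ℓ : Level) : Set (suc (c ⊔ ℓ)) where
  field
    commutativeRing : CommutativeRing c ℓ
  open CommutativeRing commutativeRing public
  field
    0≉1     : ¬ (0# ≈ 1#)
    inverse : ∀ x → ¬ (x ≈ 0#) → Σ Carrier λ y → (x * y) ≈ 1#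

Infinite : ∀ {c ℓ} → Field c ℓ → Set (c ⊔ ℓ)
Infinite K = Σ (ℕ → Carrier) λ f → ∀ m n → f m ≈ f n → m ≡ n
  where open Field K
        open import Relation.Binary.PropositionalEquality using (_≡_)

-- ℓ-uniform hypergraph with vertex set V = Fin n and edge set given by m
-- representatives e : Fin m → (Fin ℓ → Fin n) of orbits of V^ℓ under Sym(ℓ).
record Hypergraph (ℓ : ℕ) : Set where
  field
    n     : ℕ
    m     : ℕ
    edge  : Fin m → (Fin ℓ → Fin n)

Vertex : ∀ {ℓ} → Hypergraph ℓ → Set
Vertex H = Fin (Hypergraph.n H)

_^_ : ∀ {ℓ} {X : Set} → (Fin ℓ → X) → Permutation′ ℓ → (Fin ℓ → X)
(f ^ σ) a = f (σ ⟨$⟩ʳ a)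

-- Walks x_1, e_1, x_2, ..., e_{m-1}, x_m : the relation Walk H x y holds
-- iff there is a walk from x to y using at least one edge (-- the one-vertex walk is excluded, otherwise an isolated vertex x would
-- make the lemma false for x = y).
open import Relation.Binary.PropositionalEquality using (_≡_)

data Walk {ℓ} (H : Hypergraph ℓ) : Vertex H → Vertex H → Set where
  edge1 : ∀ {x y} (i : Fin (Hypergraph.m H)) (a b : Fin ℓ) →
          Hypergraph.edge H i a ≡ x → Hypergraph.edge H i b ≡ y → Walk H x y
  step : ∀ {x z y} (i : Fin (Hypergraph.m H)) (a b : Fin ℓ) →
         Hypergraph.edge H i a ≡ x → Hypergraph.edge H i b ≡ z →
         Walk H z y → Walk H x y

SameComponent : ∀ {ℓ} (H : Hypergraph ℓ) → Vertex H → Vertex H → Set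
SameComponent H x y = Walk H x y

module _ {c ℓ′} (K : Field c ℓ′) where
  open Field K

  C : ∀ {ℓ} → (Fin ℓ → Carrier) → (Fin (pred ℓ) → Carrier)
  C {zero}   v ()
  C {sucℕ k} v i = v (inject₁ i) - v (fsuc i)

  -- T-signal for T = C, with T(w) = 0 meaning every coordinate ≈ 0.
  -- δ : [ℓ] → K^V,  (δ * e^σ)(a) = δ_a (e^σ(a)).
  _✶_ : ∀ {ℓ n} → (Fin ℓ → Fin n → Carrier) → (Fin ℓ → Fin n) → (Fin ℓ → Carrier)
  (δ ✶ e) a = δ a (e a)

  IsCSignal : ∀ {ℓ} (H : Hypergraph ℓ) → (Fin ℓ → Vertex H → Carrier) → Set ℓ′
  IsCSignal {ℓ} H δ = ∀ (i : Fin (Hypergraph.m H)) (σ : Permutation′ ℓ) →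
    ∀ j → C (δ ✶ (Hypergraph.edge H i ^ σ)) j ≈ 0#

-- Within one edge e, the C-signal condition for e^σ says that a ↦ δ_a(e(a^σ))
-- is constant. Taking σ the transposition of a and p, and a third index t
-- (here ℓ ≥ 3 is used), gives δ_a(e(p)) = δ_t(e(t)), and the diagonal value
-- δ_t(e(t)) does not depend on t (σ = id). So δ is constant on the vertices
-- of each edge, across all indices, and this propagates along walks.
module Submission where

open import Defs
open import Data.Nat using (ℕ; _≤_; s≤s; suc)
open import Data.Fin using (Fin; zero; suc)
open import Data.Fin.Properties using (_≟_)
open import Data.Fin.Permutation using (_⟨$⟩ʳ_; transpose; id)
open import Data.Product using (∃; _×_; _,_)
open import Relation.Binary.PropositionalEquality using (_≡_; _≢_; refl; cong)
open import Relation.Nullary.Decidable using (dec-true; dec-false)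
import Relation.Binary.Reasoning.Setoid as ≈-Reasoning
import Algebra.Properties.Group as GroupProperties

transpose-matchˡ : ∀ {n} (i j : Fin n) → transpose i j ⟨$⟩ʳ i ≡ j
transpose-matchˡ i j rewrite dec-true (i ≟ i) refl = refl

transpose-mismatch : ∀ {n} {i j k : Fin n} → k ≢ i → k ≢ j → transpose i j ⟨$⟩ʳ k ≡ k
transpose-mismatch {i = i} {j} {k} k≢i k≢j
  rewrite dec-false (k ≟ i) k≢i | dec-false (k ≟ j) k≢j = refl

∃-distinct-from-both : ∀ {k} (i j : Fin (suc (suc (suc k)))) → ∃ λ t → t ≢ i × t ≢ j
∃-distinct-from-both (suc i)       (suc j)       = zero , (λ ()) , (λ ())
∃-distinct-from-both zero          zero          = suc zero , (λ ()) , (λ ())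
∃-distinct-from-both zero          (suc zero)    = suc (suc zero) , (λ ()) , (λ ())
∃-distinct-from-both zero          (suc (suc j)) = suc zero , (λ ()) , (λ ())
∃-distinct-from-both (suc zero)    zero          = suc (suc zero) , (λ ()) , (λ ())
∃-distinct-from-both (suc (suc i)) zero          = suc zero , (λ ()) , (λ ())

module _ {c ℓ′} (K : Field c ℓ′) where
  open Field K using (Carrier; _≈_; 0#; sym; trans; setoid; +-group) renaming (refl to ≈-refl)
  open GroupProperties +-group using (x∙y⁻¹≈ε⇒x≈y)

  C-kernel⇒≈head : ∀ {ℓ} (v : Fin (suc ℓ) → Carrier) →
                   (∀ j → C K v j ≈ 0#) → ∀ i → v i ≈ v zero
  C-kernel⇒≈head         v Cv≈0 zero    = ≈-refl
  C-kernel⇒≈head {suc ℓ} v Cv≈0 (suc i) =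
    trans (C-kernel⇒≈head (λ j → v (suc j)) (λ j → Cv≈0 (suc j)) i)
          (sym (x∙y⁻¹≈ε⇒x≈y _ _ (Cv≈0 zero)))

  C-kernel⇒constant : ∀ {ℓ} (v : Fin ℓ → Carrier) →
                      (∀ j → C K v j ≈ 0#) → ∀ i j → v i ≈ v j
  C-kernel⇒constant {suc ℓ} v Cv≈0 i j =
    trans (C-kernel⇒≈head v Cv≈0 i) (sym (C-kernel⇒≈head v Cv≈0 j))

  module CSignal {k : ℕ} (H : Hypergraph (suc (suc (suc k))))
                 (δ : Fin (suc (suc (suc k))) → Vertex H → Carrier)
                 (signal : IsCSignal K H δ) where
    open Hypergraph H

    constant-on-permuted-edge : ∀ i σ a b →
      δ a (edge i (σ ⟨$⟩ʳ a)) ≈ δ b (edge i (σ ⟨$⟩ʳ b))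
    constant-on-permuted-edge i σ = C-kernel⇒constant _ (signal i σ)

    ≈diagonal : ∀ i a p {t} → t ≢ a → t ≢ p → δ a (edge i p) ≈ δ t (edge i t)
    ≈diagonal i a p {t} t≢a t≢p = begin
      δ a (edge i p)                        ≡⟨ cong (λ q → δ a (edge i q)) (transpose-matchˡ a p) ⟨
      δ a (edge i (transpose a p ⟨$⟩ʳ a))  ≈⟨ constant-on-permuted-edge i (transpose a p) a t ⟩
      δ t (edge i (transpose a p ⟨$⟩ʳ t))  ≡⟨ cong (λ q → δ t (edge i q)) (transpose-mismatch t≢a t≢p) ⟩
      δ t (edge i t)                        ∎
      where open ≈-Reasoning setoid

    constant-on-edge : ∀ i a p b q → δ a (edge i p) ≈ δ b (edge i q)
    constant-on-edge i a p b q with ∃-distinct-from-both a p | ∃-distinct-from-both b q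
    ... | t , t≢a , t≢p | u , u≢b , u≢q =
      trans (≈diagonal i a p t≢a t≢p)
     (trans (constant-on-permuted-edge i id t u)
            (sym (≈diagonal i b q u≢b u≢q)))

    constant-along-walk : ∀ {x y} → Walk H x y → ∀ a b → δ a x ≈ δ b y
    constant-along-walk (edge1 i p q refl refl) a b = constant-on-edge i a p b q
    constant-along-walk (step i p q refl refl w) a b =
      trans (constant-on-edge i a p zero q) (constant-along-walk w zero b)

lemma4p1 : ∀ {c ℓ′} (K : Field c ℓ′) → Infinite K →
    (ℓ : ℕ) → 3 ≤ ℓ → (H : Hypergraph ℓ) → (δ : Fin ℓ → Vertex H → Field.Carrier K) →
    IsCSignal K H δ → (x y : Vertex H) → SameComponent H x y →
    (a b : Fin ℓ) → Field._≈_ K (δ a x) (δ b y)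
lemma4p1 K _ (suc (suc (suc k))) (s≤s (s≤s (s≤s _))) H δ signal x y walk =
  CSignal.constant-along-walk K H δ signal walk
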